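{- Let $n\geq 3$ and let $f\in F(n)$ be neither a constant function nor the identity. Then there exists $h\in F(n)$ with $h\sim f$ such that $\mathcal{A}(h)$ and $\mathcal{A}(f)$ are not isomorphic.
   Context: $F(n)$ is the set of all functions $f:\{0,1\}^n\to\{0,1\}^n$, written $f=(f_1,\dots,f_n)$. For $i\in[n]$, $e_i$ is the configuration with a $1$ exactly in component $i$; addition is componentwise modulo $2$. The asynchronous graph $\mathcal{A}(f)$ is the digraph on $\{0,1\}^n$ with an arc from $x$ to $x+e_i$ whenever $f_i(x)\neq x_i$. The synchronous graph $\mathcal{S}(f)$ has an arc from $x$ to $f(x)$ for every $x$. $f\sim h$ means $\mathcal{S}(f)$ and $\mathcal{S}(h)$ are isomorphic digraphs. -}

module Defs where

open import Data.Bool using (Bool; not)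
open import Data.Nat using (ℕ)
open import Data.Fin using (Fin)
open import Data.Vec using (Vec; lookup; _[_]%=_)
open import Data.Product using (∃; _×_)
open import Relation.Binary.PropositionalEquality using (_≡_; _≢_)
open import Relation.Nullary using (¬_)
open import Function.Bundles using (_↔_; Inverse)
open import Level using (0ℓ)

Config : ℕ → Set
Config n = Vec Bool n

F : ℕ → Set
F n = Config n → Config n

flip : ∀ {n} → Config n → Fin n → Config n
flip x i = x [ i ]%= not

Digraph : ℕ → Set₁
Digraph n = Config n → Config n → Set

Async : ∀ {n} → F n → Digraph n
Async f x y = ∃ λ i → (lookup (f x) i ≢ lookup x i) × (y ≡ flip x i)

Sync : ∀ {n} → F n → Digraph n
Sync f x y = f x ≡ y

Iso : ∀ {n} → Digraph n → Digraph n → Set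
Iso {n} G H = ∃ λ (φ : Config n ↔ Config n) →
  ∀ x y → (G x y → H (Inverse.to φ x) (Inverse.to φ y))
        × (H (Inverse.to φ x) (Inverse.to φ y) → G x y)

_∼_ : ∀ {n} → F n → F n → Set
f ∼ h = Iso (Sync f) (Sync h)

IsConstant : ∀ {n} → F n → Set
IsConstant {n} f = ∃ λ (c : Config n) → ∀ x → f x ≡ c

IsIdentity : ∀ {n} → F n → Set
IsIdentity f = ∀ x → f x ≡ x

{-# OPTIONS --safe #-}
-- In A(f) a configuration x has n distinct successors exactly when f x = ~ x, so the number
-- of such antipodal points of f, and whether one of them lies on a 2-cycle, are invariants of
-- A(f) up to isomorphism, while conjugating f by a permutation of the cube does not change S(f)
-- up to isomorphism.  Conjugating by the transposition (a b) changes the count by the number of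
-- arcs of f joining the pairs {a, ~ b}, {b, ~ a} minus the number inside the pairs {a, ~ a},
-- {b, ~ b}.  Without antipodal points any arc x ↦ f x ≠ x makes this difference positive for
-- suitable a, b.  If p is antipodal and all these differences vanish, the two at (p, q) and
-- (p, ~ q) force a rigid pattern of f on every pair {q, ~ q}; from it one finds a conjugate for
-- which some difference is nonzero, unless f is constant or a "broom": c ↦ d ↦ d and everything
-- else ↦ c.  A broom has an antipodal point on a 2-cycle exactly when d = ~ c, and a suitable
-- transposition turns one kind of broom into the other.

module Submission where

open import Defs
open import Data.Bool using (Bool; true; false; not; T; _∧_)
import Data.Bool as Bool
open import Data.Bool.Properties using (not-involutive; not-¬; ¬-not)
open import Data.Empty using (⊥; ⊥-elim)
open import Data.Fin using (Fin; punchOut) renaming (zero to 0F; suc to sucF)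
import Data.Fin.Properties as Fin
open import Data.List using (List; []; _∷_)
import Data.List as List
open import Data.List.Membership.Propositional using (_∉_)
open import Data.List.Properties using (map-cong-local)
import Data.List.Relation.Unary.All as All
open import Data.List.Relation.Unary.All using ([]; _∷_)
open import Data.List.Relation.Unary.AllPairs using ([]; _∷_)
open import Data.List.Relation.Unary.Any using (here; there)
open import Data.List.Relation.Unary.Unique.Propositional using (Unique)
open import Data.Nat using (ℕ; zero; suc; _+_; _*_; _≥_; s≤s)
import Data.Nat as ℕ
open import Data.Nat.ListAction using (sum)
open import Data.Nat.Properties using (+-identityʳ; +-cancelˡ-≡; +-comm; +-assoc; n<1+n; 0≢1+n)
open import Data.Nat.Tactic.RingSolver using (solve-∀)
open import Data.Product using (∃; _×_; _,_; proj₁; proj₂)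
import Data.Product as Product
open import Data.Sum using (_⊎_; inj₁; inj₂)
import Data.Sum as Sum
open import Data.Vec using ([]; _∷_; lookup; map; head)
open import Data.Vec.Properties
  using (≡-dec; ∷-injectiveʳ; lookup-map; map-∘; map-cong; map-id;
         lookup∘updateAt; lookup∘updateAt′; updateAt-updateAt; updateAt-cong; updateAt-id)
open import Data.Vec.Relation.Binary.Pointwise.Extensional using (ext; Pointwise-≡⇒≡)
open import Function using (_∘_; id)
open import Function.Bundles using (_↔_; Inverse; Injection; mk↔ₛ′)
open import Function.Properties.Inverse using (↔⇒↣)
open import Function.Construct.Composition using (_↔-∘_)
open import Function.Construct.Identity using (↔-id)
open import Function.Construct.Symmetry using (↔-sym)
open import Function.Definitions using (Injective)
open import Relation.Binary.Definitions using (DecidableEquality)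
open import Relation.Binary.PropositionalEquality
open import Relation.Nullary using (¬_; Dec; yes; no; does; contradiction)
open import Relation.Nullary.Decidable
  using (map′; ¬?; decidable-stable; _⊎-dec_; _×-dec_; _→-dec_; T?; from-yes; dec-true; dec-false)

infix 4 _≟_
_≟_ : ∀ {n} → DecidableEquality (Config n)
_≟_ = ≡-dec Bool._≟_

infix 9 ~_
~_ : ∀ {n} → Config n → Config n
~_ = map not

lookup-~ : ∀ {n} (x : Config n) i → lookup (~ x) i ≡ not (lookup x i)
lookup-~ x i = lookup-map i not x

~-involutive : ∀ {n} (x : Config n) → ~ ~ x ≡ x
~-involutive x = trans (sym (map-∘ not not x)) (trans (map-cong not-involutive x) (map-id x))

~-injective : ∀ {n} {x y : Config n} → ~ x ≡ ~ y → x ≡ y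
~-injective {x = x} {y} e = trans (sym (~-involutive x)) (trans (cong ~_ e) (~-involutive y))

~-sym : ∀ {n} {x y : Config n} → x ≡ ~ y → y ≡ ~ x
~-sym {y = y} e = trans (sym (~-involutive y)) (cong ~_ (sym e))

lookup-~-≢ : ∀ {n} (x : Config n) i → lookup (~ x) i ≢ lookup x i
lookup-~-≢ x i e = not-¬ refl (trans (sym e) (lookup-~ x i))

~-≢ : ∀ {n} (x : Config (suc n)) → ~ x ≢ x
~-≢ (b ∷ _) e = not-¬ refl (sym (cong head e))

flip-same : ∀ {n} (x : Config n) i → lookup (flip x i) i ≡ not (lookup x i)
flip-same x i = lookup∘updateAt i x

flip-other : ∀ {n} (x : Config n) {i j} → i ≢ j → lookup (flip x j) i ≡ lookup x i
flip-other x {i} {j} i≢j = lookup∘updateAt′ i j i≢j x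

flip-involutive : ∀ {n} (x : Config n) i → flip (flip x i) i ≡ x
flip-involutive x i =
  trans (updateAt-updateAt i x) (trans (updateAt-cong i not-involutive x) (updateAt-id i x))

flip-≢ : ∀ {n} (x : Config n) i → flip x i ≢ x
flip-≢ x i e = not-¬ refl (sym (trans (sym (flip-same x i)) (cong (λ y → lookup y i) e)))

flip-injective : ∀ {n} (x : Config n) {i j} → flip x i ≡ flip x j → i ≡ j
flip-injective x {i} {j} e with i Fin.≟ j
... | yes i≡j = i≡j
... | no i≢j = contradiction (sym (trans (sym (flip-same x i)) (trans (cong (λ y → lookup y i) e) (flip-other x i≢j))))
                            (not-¬ refl)

flip-≢-~ : ∀ {m} (x : Config (suc (suc m))) i → flip x i ≢ ~ x
flip-≢-~ x i e = not-¬ refl (trans (sym (flip-other x (≢-sym i≢j))) (trans (cong (λ y → lookup y j) e) (lookup-~ x j)))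
  where
  another : ∀ {m} (i : Fin (suc (suc m))) → ∃ λ j → i ≢ j
  another 0F = sucF 0F , λ ()
  another (sucF _) = 0F , λ ()
  j = proj₁ (another i)
  i≢j = proj₂ (another i)

flip₁-≢-~flip₀ : ∀ {m} (p : Config (suc (suc (suc m)))) → flip p (sucF 0F) ≢ ~ flip p 0F
flip₁-≢-~flip₀ p e = not-¬ refl (trans (sym (flip-other p λ ()))
  (trans (cong (λ y → lookup y i₂) e) (trans (lookup-~ (flip p 0F) i₂) (cong not (flip-other p λ ())))))
  where
  i₂ = sucF (sucF 0F)

outside-two-pairs : ∀ {m} (p u : Config (suc (suc (suc m)))) → ∃ λ q → q ≢ p × q ≢ ~ p × q ≢ u × q ≢ ~ u
outside-two-pairs p u with flip p 0F ≟ u | flip p 0F ≟ ~ u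
... | no ≢u | no ≢~u = flip p 0F , flip-≢ p 0F , flip-≢-~ p 0F , ≢u , ≢~u
... | yes refl | _ = flip p (sucF 0F) , flip-≢ p (sucF 0F) , flip-≢-~ p (sucF 0F) ,
                     (λ e → Fin.0≢1+n (sym (flip-injective p e))) , flip₁-≢-~flip₀ p
... | no _ | yes e = flip p (sucF 0F) , flip-≢ p (sucF 0F) , flip-≢-~ p (sucF 0F) ,
                     (λ e′ → flip₁-≢-~flip₀ p (trans e′ (~-sym e))) ,
                     (λ e′ → Fin.0≢1+n (sym (flip-injective p (trans e′ (sym e)))))

-- Opaque: with-abstraction over a search must not unfold it.
opaque
  any? : ∀ {n} {p} {P : Config n → Set p} → (∀ x → Dec (P x)) → Dec (∃ P)
  any? {zero} P? = map′ ([] ,_) (λ { ([] , p) → p }) (P? [])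
  any? {suc n} {P = P} P? = map′ join split (any? (P? ∘ (false ∷_)) ⊎-dec any? (P? ∘ (true ∷_)))
    where
    join : ∃ (P ∘ (false ∷_)) ⊎ ∃ (P ∘ (true ∷_)) → ∃ P
    join (inj₁ (x , p)) = false ∷ x , p
    join (inj₂ (x , p)) = true ∷ x , p
    split : ∃ P → ∃ (P ∘ (false ∷_)) ⊎ ∃ (P ∘ (true ∷_))
    split (false ∷ x , p) = inj₁ (x , p)
    split (true ∷ x , p) = inj₂ (x , p)

𝟙 : Bool → ℕ
𝟙 true = 1
𝟙 false = 0

δ : ∀ {n} → Config n → Config n → ℕ
δ x y = 𝟙 (does (x ≟ y))

δ-≡ : ∀ {n} {x y : Config n} → x ≡ y → δ x y ≡ 1
δ-≡ {x = x} {y} x≡y = cong 𝟙 (dec-true (x ≟ y) x≡y)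

δ-≢ : ∀ {n} {x y : Config n} → x ≢ y → δ x y ≡ 0
δ-≢ {x = x} {y} x≢y = cong 𝟙 (dec-false (x ≟ y) x≢y)

δ-cong : ∀ {n} {x y x′ y′ : Config n} →
         (x ≡ y → x′ ≡ y′) → (x′ ≡ y′ → x ≡ y) → δ x y ≡ δ x′ y′
δ-cong {x = x} {y} to from with x ≟ y
... | yes x≡y = sym (δ-≡ (to x≡y))
... | no x≢y = sym (δ-≢ (x≢y ∘ from))

∑ : ∀ {n} → (Config n → ℕ) → ℕ
∑ {zero} F = F []
∑ {suc n} F = ∑ (F ∘ (false ∷_)) + ∑ (F ∘ (true ∷_))

∑-cong : ∀ {n} {F G : Config n → ℕ} → (∀ x → F x ≡ G x) → ∑ F ≡ ∑ G
∑-cong {zero} F≗G = F≗G []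
∑-cong {suc n} F≗G = cong₂ _+_ (∑-cong (F≗G ∘ (false ∷_))) (∑-cong (F≗G ∘ (true ∷_)))

∑-zero : ∀ {n} → ∑ {n} (λ _ → 0) ≡ 0
∑-zero {zero} = refl
∑-zero {suc n} = cong₂ _+_ (∑-zero {n}) (∑-zero {n})

∑-distrib-+ : ∀ {n} (F G : Config n → ℕ) → ∑ (λ x → F x + G x) ≡ ∑ F + ∑ G
∑-distrib-+ {zero} F G = refl
∑-distrib-+ {suc n} F G = trans
  (cong₂ _+_ (∑-distrib-+ (F ∘ (false ∷_)) (G ∘ (false ∷_))) (∑-distrib-+ (F ∘ (true ∷_)) (G ∘ (true ∷_))))
  (interchange (∑ (F ∘ (false ∷_))) (∑ (G ∘ (false ∷_))) (∑ (F ∘ (true ∷_))) (∑ (G ∘ (true ∷_))))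
  where
  interchange : ∀ a b c d → (a + b) + (c + d) ≡ (a + c) + (b + d)
  interchange = solve-∀

∑-comm : ∀ {m n} (F : Config m → Config n → ℕ) → ∑ (λ x → ∑ (F x)) ≡ ∑ (λ y → ∑ (λ x → F x y))
∑-comm {zero} F = refl
∑-comm {suc m} F = trans (cong₂ _+_ (∑-comm (F ∘ (false ∷_))) (∑-comm (F ∘ (true ∷_))))
  (sym (∑-distrib-+ (λ y → ∑ (λ x → F (false ∷ x) y)) (λ y → ∑ (λ x → F (true ∷ x) y))))

∑-δ : ∀ {n} (a : Config n) (F : Config n → ℕ) → ∑ (λ x → δ x a * F x) ≡ F a
∑-δ {zero} [] F = +-identityʳ (F [])
∑-δ {suc n} (false ∷ a) F =
  trans (cong₂ _+_ (∑-δ a (F ∘ (false ∷_))) (∑-zero {n})) (+-identityʳ (F (false ∷ a)))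
∑-δ {suc n} (true ∷ a) F = cong₂ _+_ (∑-zero {n}) (∑-δ a (F ∘ (true ∷_)))

∑-reindex : ∀ {n} (φ : Config n ↔ Config n) (F : Config n → ℕ) → ∑ (F ∘ Inverse.to φ) ≡ ∑ F
∑-reindex φ F = begin
  ∑ (λ x → F (to x))                     ≡⟨ ∑-cong (λ x → sym (∑-δ (to x) F)) ⟩
  ∑ (λ x → ∑ (λ y → δ y (to x) * F y))   ≡⟨ ∑-comm (λ x y → δ y (to x) * F y) ⟩
  ∑ (λ y → ∑ (λ x → δ y (to x) * F y))   ≡⟨ ∑-cong (λ y → ∑-cong (λ x → cong (_* F y) (δ-to-from x y))) ⟩
  ∑ (λ y → ∑ (λ x → δ x (from y) * F y)) ≡⟨ ∑-cong (λ y → ∑-δ (from y) (λ _ → F y)) ⟩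
  ∑ F                                    ∎
  where
  open Inverse φ
  open ≡-Reasoning
  δ-to-from : ∀ x y → δ y (to x) ≡ δ x (from y)
  δ-to-from x y = δ-cong (λ y≡to-x → trans (sym (strictlyInverseʳ x)) (cong from (sym y≡to-x)))
                         (λ x≡from-y → trans (sym (strictlyInverseˡ y)) (cong to (sym x≡from-y)))

∑-update : ∀ {n} {F G : Config n → ℕ} (a : Config n) →
           (∀ x → x ≢ a → F x ≡ G x) → ∑ F + G a ≡ ∑ G + F a
∑-update {zero} {F} {G} [] _ = +-comm (F []) (G [])
∑-update {suc n} {F} {G} (false ∷ a) F≗G = begin
  (∑ F₀ + ∑ F₁) + G (false ∷ a) ≡⟨ +-comm-middle (∑ F₀) (∑ F₁) _ ⟩
  (∑ F₀ + G (false ∷ a)) + ∑ F₁ ≡⟨ cong₂ _+_ (∑-update a (λ x x≢a → F≗G (false ∷ x) (x≢a ∘ ∷-injectiveʳ)))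
                                               (∑-cong (λ x → F≗G (true ∷ x) λ ())) ⟩
  (∑ G₀ + F (false ∷ a)) + ∑ G₁ ≡⟨ +-comm-middle (∑ G₀) _ (∑ G₁) ⟩
  (∑ G₀ + ∑ G₁) + F (false ∷ a) ∎
  where
  open ≡-Reasoning
  F₀ = F ∘ (false ∷_); F₁ = F ∘ (true ∷_); G₀ = G ∘ (false ∷_); G₁ = G ∘ (true ∷_)
  +-comm-middle : ∀ a b c → (a + b) + c ≡ (a + c) + b
  +-comm-middle = solve-∀
∑-update {suc n} {F} {G} (true ∷ a) F≗G = begin
  (∑ F₀ + ∑ F₁) + G (true ∷ a) ≡⟨ +-assoc (∑ F₀) _ _ ⟩
  ∑ F₀ + (∑ F₁ + G (true ∷ a)) ≡⟨ cong₂ _+_ (∑-cong (λ x → F≗G (false ∷ x) λ ()))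
                                             (∑-update a (λ x x≢a → F≗G (true ∷ x) (x≢a ∘ ∷-injectiveʳ))) ⟩
  ∑ G₀ + (∑ G₁ + F (true ∷ a)) ≡⟨ +-assoc (∑ G₀) _ _ ⟨
  (∑ G₀ + ∑ G₁) + F (true ∷ a) ∎
  where
  open ≡-Reasoning
  F₀ = F ∘ (false ∷_); F₁ = F ∘ (true ∷_); G₀ = G ∘ (false ∷_); G₁ = G ∘ (true ∷_)

∑-agree-outside : ∀ {n} {F G : Config n → ℕ} (S : List (Config n)) → Unique S →
                  (∀ x → x ∉ S → F x ≡ G x) → ∑ F + sum (List.map G S) ≡ ∑ G + sum (List.map F S)
∑-agree-outside [] _ F≗G = cong (_+ 0) (∑-cong (λ x → F≗G x λ ()))
∑-agree-outside {F = F} {G} (s ∷ S) (s∉S ∷ S-unique) F≗G = begin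
  ∑ F + (G s + ∑ˢ G) ≡⟨ cong (λ v → ∑ F + (v + ∑ˢ G)) (sym H-at-s) ⟩
  ∑ F + (H s + ∑ˢ G) ≡⟨ +-assoc (∑ F) _ _ ⟨
  (∑ F + H s) + ∑ˢ G ≡⟨ cong (_+ ∑ˢ G) (∑-update s λ x x≢s → sym (H≗F x x≢s)) ⟩
  (∑ H + F s) + ∑ˢ G ≡⟨ +-comm-middle (∑ H) (F s) (∑ˢ G) ⟩
  (∑ H + ∑ˢ G) + F s ≡⟨ cong (_+ F s) (∑-agree-outside S S-unique H≗G) ⟩
  (∑ G + ∑ˢ H) + F s ≡⟨ cong (λ v → (∑ G + sum v) + F s)
                             (map-cong-local (All.map (λ s≢x → H≗F _ (s≢x ∘ sym)) s∉S)) ⟩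
  (∑ G + ∑ˢ F) + F s ≡⟨ +-comm-middle (∑ G) (F s) (∑ˢ F) ⟨
  (∑ G + F s) + ∑ˢ F ≡⟨ +-assoc (∑ G) _ _ ⟩
  ∑ G + (F s + ∑ˢ F) ∎
  where
  open ≡-Reasoning
  ∑ˢ : (Config _ → ℕ) → ℕ
  ∑ˢ K = sum (List.map K S)
  +-comm-middle : ∀ a b c → (a + b) + c ≡ (a + c) + b
  +-comm-middle = solve-∀
  H : Config _ → ℕ
  H x = Bool.if does (x ≟ s) then G x else F x
  H≗F : ∀ x → x ≢ s → H x ≡ F x
  H≗F x x≢s with x ≟ s
  ... | yes x≡s = contradiction x≡s x≢s
  ... | no _ = refl
  H-at-s : H s ≡ G s
  H-at-s with s ≟ s
  ... | yes _ = refl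
  ... | no s≢s = contradiction refl s≢s
  H≗G : ∀ x → x ∉ S → H x ≡ G x
  H≗G x x∉S with x ≟ s
  ... | yes _ = refl
  ... | no x≢s = F≗G x λ { (here x≡s) → x≢s x≡s ; (there x∈S) → x∉S x∈S }

-- Opaque, so that unification treats swap a b x as rigid.
opaque
  swap : ∀ {n} → Config n → Config n → Config n → Config n
  swap a b x with x ≟ a
  ... | yes _ = b
  ... | no _ with x ≟ b
  ...   | yes _ = a
  ...   | no _ = x

  swap-first : ∀ {n} (a b : Config n) → swap a b a ≡ b
  swap-first a b with a ≟ a
  ... | yes _ = refl
  ... | no a≢a = contradiction refl a≢a

  swap-second : ∀ {n} (a b : Config n) → swap a b b ≡ a
  swap-second a b with b ≟ a
  ... | yes b≡a = b≡a
  ... | no _ with b ≟ b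
  ...   | yes _ = refl
  ...   | no b≢b = contradiction refl b≢b

  swap-other : ∀ {n} (a b : Config n) {x} → x ≢ a → x ≢ b → swap a b x ≡ x
  swap-other a b {x} x≢a x≢b with x ≟ a
  ... | yes x≡a = contradiction x≡a x≢a
  ... | no _ with x ≟ b
  ...   | yes x≡b = contradiction x≡b x≢b
  ...   | no _ = refl

  swap-involutive : ∀ {n} (a b : Config n) x → swap a b (swap a b x) ≡ x
  swap-involutive a b x with x ≟ a
  ... | yes x≡a = trans (swap-second a b) (sym x≡a)
  ... | no x≢a with x ≟ b
  ...   | yes x≡b = trans (swap-first a b) (sym x≡b)
  ...   | no x≢b = swap-other a b x≢a x≢b

swap-adjoint : ∀ {n} (a b : Config n) {x y} → swap a b x ≡ y → x ≡ swap a b y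
swap-adjoint a b {x} e = trans (sym (swap-involutive a b x)) (cong (swap a b) e)

transposition : ∀ {n} (a b : Config n) → Config n ↔ Config n
transposition a b = mk↔ₛ′ (swap a b) (swap a b) (swap-involutive a b) (swap-involutive a b)

conj : ∀ {n} → Config n → Config n → F n → F n
conj a b g = swap a b ∘ g ∘ swap a b

conj-eval : ∀ {n} (g : F n) {a b x x′ y y′ : Config n} →
            swap a b x ≡ x′ → g x′ ≡ y → swap a b y ≡ y′ → conj a b g x ≡ y′
conj-eval g {a} {b} e₁ e₂ e₃ = trans (cong (swap a b) (trans (cong g e₁) e₂)) e₃

Iso-refl : ∀ {n} (G : Digraph n) → Iso G G
Iso-refl G = ↔-id _ , λ _ _ → id , id

Iso-sym : ∀ {n} {G H : Digraph n} → Iso G H → Iso H G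
Iso-sym {H = H} (φ , φ-arcs) = ↔-sym φ , λ x y →
  (λ Hxy → proj₂ (φ-arcs (from x) (from y))
             (subst₂ H (sym (strictlyInverseˡ x)) (sym (strictlyInverseˡ y)) Hxy)) ,
  (λ Gxy → subst₂ H (strictlyInverseˡ x) (strictlyInverseˡ y) (proj₁ (φ-arcs (from x) (from y)) Gxy))
  where open Inverse φ

Iso-trans : ∀ {n} {G H J : Digraph n} → Iso G H → Iso H J → Iso G J
Iso-trans (φ , φ-arcs) (ψ , ψ-arcs) = ψ ↔-∘ φ , λ x y →
  (proj₁ (ψ-arcs _ _) ∘ proj₁ (φ-arcs x y)) , (proj₂ (φ-arcs x y) ∘ proj₂ (ψ-arcs _ _))

conj-∼ : ∀ {n} (a b : Config n) (g : F n) → conj a b g ∼ g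
conj-∼ a b g = transposition a b , λ x y →
  swap-adjoint a b , (λ e → trans (cong (swap a b) e) (swap-involutive a b y))

-- Invariants of the asynchronous graph

injective⇒surjective : ∀ {n} {j : Fin n → Fin n} → Injective _≡_ _≡_ j → ∀ k → ∃ λ i → j i ≡ k
injective⇒surjective {suc m} {j} j-inj k with Fin.any? (λ i → j i Fin.≟ k)
... | yes hit = hit
... | no miss = ⊥-elim (Fin.<⇒notInjective (n<1+n m) squeeze-injective)
  where
  k≢j : ∀ i → k ≢ j i
  k≢j i k≡ji = miss (i , sym k≡ji)
  squeeze-injective : Injective _≡_ _≡_ (λ i → punchOut (k≢j i))
  squeeze-injective e = j-inj (Fin.punchOut-injective (k≢j _) (k≢j _) e)

FullOutDegree : ∀ {n} → Digraph n → Config n → Set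
FullOutDegree {n} G x = ∃ λ (s : Fin n → Config n) → Injective _≡_ _≡_ s × (∀ i → G x (s i))

FullVertexOnTwoCycle : ∀ {n} → Digraph n → Set
FullVertexOnTwoCycle G = ∃ λ x → FullOutDegree G x × ∃ λ y → G x y × G y x

antipodal-arc : ∀ {n} (f : F n) {x} → f x ≡ ~ x → ∀ i → Async f x (flip x i)
antipodal-arc f {x} fx≡~x i = i , (λ e → lookup-~-≢ x i (trans (cong (λ y → lookup y i) (sym fx≡~x)) e)) , refl

antipodal⇒full : ∀ {n} (f : F n) {x} → f x ≡ ~ x → FullOutDegree (Async f) x
antipodal⇒full f {x} fx≡~x = flip x , flip-injective x , antipodal-arc f fx≡~x

-- The arcs to n distinct successors of x go in n distinct directions, hence in all of them.
full⇒antipodal : ∀ {n} (f : F n) {x} → FullOutDegree (Async f) x → f x ≡ ~ x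
full⇒antipodal f {x} (s , s-inj , arcs) =
  Pointwise-≡⇒≡ (ext λ k → trans (¬-not (differs k)) (sym (lookup-~ x k)))
  where
  direction : ∀ i → ∃ λ j → lookup (f x) j ≢ lookup x j × s i ≡ flip x j
  direction = arcs
  direction-injective : Injective _≡_ _≡_ (proj₁ ∘ direction)
  direction-injective {i} {i′} e = s-inj (trans (proj₂ (proj₂ (direction i)))
    (trans (cong (flip x) e) (sym (proj₂ (proj₂ (direction i′))))))
  differs : ∀ k → lookup (f x) k ≢ lookup x k
  differs k with injective⇒surjective direction-injective k
  ... | i , refl = proj₁ (proj₂ (direction i))

module _ {n : ℕ} {G H : Digraph n} (iso : Iso G H) where
  private
    φ = proj₁ iso
    open Inverse φ using (to)
    preserves : ∀ {x y} → G x y → H (to x) (to y)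
    preserves = proj₁ (proj₂ iso _ _)

  full-transport : ∀ {x} → FullOutDegree G x → FullOutDegree H (to x)
  full-transport (s , s-inj , arcs) = to ∘ s , s-inj ∘ Injection.injective (↔⇒↣ φ) , preserves ∘ arcs

  twoCycle-transport : FullVertexOnTwoCycle G → FullVertexOnTwoCycle H
  twoCycle-transport (x , x-full , y , Gxy , Gyx) = to x , full-transport x-full , to y , preserves Gxy , preserves Gyx

antipodalCount : ∀ {n} → F n → ℕ
antipodalCount f = ∑ λ x → δ (f x) (~ x)

antipodalCount-invariant : ∀ {n} {h f : F n} → Iso (Async h) (Async f) → antipodalCount h ≡ antipodalCount f
antipodalCount-invariant {h = h} {f} iso = trans (∑-cong same) (∑-reindex φ (λ y → δ (f y) (~ y)))
  where
  φ = proj₁ iso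
  open Inverse φ using (to; strictlyInverseʳ)
  same : ∀ x → δ (h x) (~ x) ≡ δ (f (to x)) (~ (to x))
  same x = δ-cong
    (full⇒antipodal f ∘ full-transport {G = Async h} {Async f} iso ∘ antipodal⇒full h)
    (subst (λ z → h z ≡ ~ z) (strictlyInverseʳ x) ∘ full⇒antipodal h ∘
     full-transport {G = Async f} {Async h} (Iso-sym {G = Async h} iso) ∘ antipodal⇒full f)

-- The effect of a transposition on the antipodal count

linked : ∀ {n} → F n → Config n → Config n → ℕ
linked g x y = δ (g x) y + δ (g y) x

linkedWithin : ∀ {n} → F n → Config n → Config n → ℕ
linkedWithin g a b = linked g a (~ a) + linked g b (~ b)

linkedAcross : ∀ {n} → F n → Config n → Config n → ℕ
linkedAcross g a b = linked g a (~ b) + linked g b (~ a)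

-- Conjugating by τ = (a b) replaces the matching x ↦ ~ x by π = τ ∘ ~_ ∘ τ, which differs
-- from it only on a, ~ a, b, ~ b.
module _ {n : ℕ} (g : F (suc n)) {a b : Config (suc n)} (b≢a : b ≢ a) (b≢~a : b ≢ ~ a) where
  private
    τ = swap a b
    π : Config (suc n) → Config (suc n)
    π = τ ∘ ~_ ∘ τ

    ~a≢a : ~ a ≢ a
    ~a≢a = ~-≢ a
    ~b≢b : ~ b ≢ b
    ~b≢b = ~-≢ b
    ~b≢a : ~ b ≢ a
    ~b≢a = b≢~a ∘ ~-sym ∘ sym
    ~b≢~a : ~ b ≢ ~ a
    ~b≢~a = b≢a ∘ ~-injective

    π-a : π a ≡ ~ b
    π-a = trans (cong (τ ∘ ~_) (swap-first a b)) (swap-other a b ~b≢a ~b≢b)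
    π-b : π b ≡ ~ a
    π-b = trans (cong (τ ∘ ~_) (swap-second a b)) (swap-other a b ~a≢a (≢-sym b≢~a))
    π-~a : π (~ a) ≡ b
    π-~a = trans (cong (τ ∘ ~_) (swap-other a b ~a≢a (≢-sym b≢~a)))
                 (trans (cong τ (~-involutive a)) (swap-first a b))
    π-~b : π (~ b) ≡ a
    π-~b = trans (cong (τ ∘ ~_) (swap-other a b ~b≢a ~b≢b))
                 (trans (cong τ (~-involutive b)) (swap-second a b))

    corners : List (Config (suc n))
    corners = a ∷ ~ a ∷ b ∷ ~ b ∷ []

    corners-unique : Unique corners
    corners-unique = (≢-sym ~a≢a ∷ ≢-sym b≢a ∷ ≢-sym ~b≢a ∷ [])
                   ∷ (≢-sym b≢~a ∷ ≢-sym ~b≢~a ∷ [])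
                   ∷ (≢-sym ~b≢b ∷ [])
                   ∷ [] ∷ []

    π-outside : ∀ x → x ∉ corners → π x ≡ ~ x
    π-outside x x∉ = trans (cong (τ ∘ ~_) (swap-other a b (x∉ ∘ here) (x∉ ∘ there ∘ there ∘ here)))
      (swap-other a b (x∉ ∘ there ∘ here ∘ ~-sym ∘ sym) (x∉ ∘ there ∘ there ∘ there ∘ here ∘ ~-sym ∘ sym))

    count-conj : antipodalCount (conj a b g) ≡ ∑ (λ y → δ (g y) (π y))
    count-conj = trans (∑-cong moved) (∑-reindex (transposition a b) (λ y → δ (g y) (π y)))
      where
      moved : ∀ x → δ (τ (g (τ x))) (~ x) ≡ δ (g (τ x)) (π (τ x))
      moved x = δ-cong {x′ = g (τ x)} {π (τ x)}
                       (λ e → trans (swap-adjoint a b e) (cong (τ ∘ ~_) (sym (swap-involutive a b x))))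
                       (λ e → sym (swap-adjoint a b (sym (trans e (cong (τ ∘ ~_) (swap-involutive a b x))))))

  transposition-formula : antipodalCount (conj a b g) + linkedWithin g a b ≡ antipodalCount g + linkedAcross g a b
  transposition-formula = begin
    antipodalCount (conj a b g) + linkedWithin g a b
      ≡⟨ cong₂ _+_ count-conj within ⟩
    ∑ (λ y → δ (g y) (π y)) + sum (List.map (λ y → δ (g y) (~ y)) corners)
      ≡⟨ ∑-agree-outside corners corners-unique (λ x x∉ → cong (δ (g x)) (π-outside x x∉)) ⟩
    antipodalCount g + sum (List.map (λ y → δ (g y) (π y)) corners)
      ≡⟨ cong (antipodalCount g +_) across ⟩
    antipodalCount g + linkedAcross g a b ∎
    where
    open ≡-Reasoning
    within : linkedWithin g a b ≡ sum (List.map (λ y → δ (g y) (~ y)) corners)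
    within = trans
      (cong₂ (λ u v → (δ (g a) (~ a) + u) + (δ (g b) (~ b) + v))
             (cong (δ (g (~ a))) (sym (~-involutive a))) (cong (δ (g (~ b))) (sym (~-involutive b))))
      (reassociate (δ (g a) (~ a)) (δ (g (~ a)) (~ ~ a)) (δ (g b) (~ b)) (δ (g (~ b)) (~ ~ b)))
      where
      reassociate : ∀ x y z w → (x + y) + (z + w) ≡ x + (y + (z + (w + 0)))
      reassociate = solve-∀
    across : sum (List.map (λ y → δ (g y) (π y)) corners) ≡ linkedAcross g a b
    across = trans
      (cong₂ _+_ (cong (δ (g a)) π-a)
        (cong₂ _+_ (cong (δ (g (~ a))) π-~a) (cong₂ _+_ (cong (δ (g b)) π-b) (cong (λ u → δ (g (~ b)) u + 0) π-~b))))
      (regroup (δ (g a) (~ b)) (δ (g (~ a)) b) (δ (g b) (~ a)) (δ (g (~ b)) a))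
      where
      regroup : ∀ x y z w → x + (y + (z + (w + 0))) ≡ (x + w) + (z + y)
      regroup = solve-∀

Separable : ∀ {n} → F n → Set
Separable {n} f = ∃ λ (h : F n) → (h ∼ f) × ¬ Iso (Async h) (Async f)

separable-if-count-differs : ∀ {n} {f g : F n} → g ∼ f → antipodalCount g ≢ antipodalCount f → Separable f
separable-if-count-differs {f = f} {g} g∼f differs = g , g∼f , differs ∘ antipodalCount-invariant {h = g} {f}

separable-if-unbalanced : ∀ {n} {f g : F (suc n)} {a b} → g ∼ f → b ≢ a → b ≢ ~ a →
                          linkedAcross g a b ≢ linkedWithin g a b → Separable f
separable-if-unbalanced {f = f} {g} {a} {b} g∼f b≢a b≢~a unbalanced
  with antipodalCount g ℕ.≟ antipodalCount f
... | no differs = separable-if-count-differs {f = f} {g} g∼f differs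
... | yes same = separable-if-count-differs {f = f} {conj a b g} conj∼f λ conj≡f →
  unbalanced (sym (+-cancelˡ-≡ (antipodalCount g) _ _
    (trans (cong (_+ linkedWithin g a b) (trans same (sym conj≡f))) (transposition-formula g {a} {b} b≢a b≢~a))))
  where
  conj∼f : conj a b g ∼ f
  conj∼f = Iso-trans {G = Sync (conj a b g)} {Sync g} {Sync f} (conj-∼ a b g) g∼f

Unlinked : ∀ {n} → F n → Config n → Set
Unlinked g a = g a ≢ ~ a × g (~ a) ≢ a

unlinked⇒linked≡0 : ∀ {n} {g : F n} {a} → Unlinked g a → linked g a (~ a) ≡ 0
unlinked⇒linked≡0 (ga≢~a , g~a≢a) = cong₂ _+_ (δ-≢ ga≢~a) (δ-≢ g~a≢a)

unlinked-~ : ∀ {n} {g : F n} {a} → Unlinked g a → Unlinked g (~ a)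
unlinked-~ {g = g} {a} (ga≢~a , g~a≢a) =
  (λ e → g~a≢a (trans e (~-involutive a))) , (λ e → ga≢~a (trans (cong g (sym (~-involutive a))) e))

-- The arc a ↦ b joins the antipodal pairs of a and b, which carry no arcs themselves, so the
-- transposition (a ~ b) is unbalanced.
separable-from-arc : ∀ {n} {f g : F (suc n)} {a b} → g ∼ f → g a ≡ b → b ≢ a → b ≢ ~ a →
                     Unlinked g a → Unlinked g b → Separable f
separable-from-arc {f = f} {g} {a} {b} g∼f ga≡b b≢a b≢~a a-unlinked b-unlinked =
  separable-if-unbalanced {f = f} {g} {a} {~ b} g∼f (b≢~a ∘ ~-sym ∘ sym) (b≢a ∘ ~-injective) λ across≡within →
    0≢1+n (trans (sym within≡0) (trans (sym across≡within) across≡1+))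
  where
  within≡0 : linkedWithin g a (~ b) ≡ 0
  within≡0 = cong₂ _+_ (unlinked⇒linked≡0 {g = g} a-unlinked)
                       (unlinked⇒linked≡0 {g = g} (unlinked-~ {g = g} b-unlinked))
  across≡1+ : linkedAcross g a (~ b) ≡ (1 + δ (g (~ ~ b)) a) + linked g (~ b) (~ a)
  across≡1+ = cong (λ u → (u + δ (g (~ ~ b)) a) + linked g (~ b) (~ a))
                   (δ-≡ (trans ga≡b (sym (~-involutive b))))

-- Brooms

Broom : ∀ {n} → F n → Config n → Config n → Set
Broom f c d = f c ≡ d × f d ≡ d × (∀ x → x ≢ c → x ≢ d → f x ≡ c)

broom-conj : ∀ {n} {f : F n} {c d} a b → Broom f c d → Broom (conj a b f) (swap a b c) (swap a b d)
broom-conj {f = f} {c} {d} a b (fc≡d , fd≡d , elsewhere) =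
  conj-eval f (swap-involutive a b c) fc≡d refl ,
  conj-eval f (swap-involutive a b d) fd≡d refl ,
  λ x x≢ x≢′ → conj-eval f refl (elsewhere (swap a b x) (x≢ ∘ swap-adjoint a b) (x≢′ ∘ swap-adjoint a b)) refl

module _ {m : ℕ} {f : F (suc (suc m))} {c d : Config (suc (suc m))} (broom : Broom f c d) where
  private
    fc≡d = proj₁ broom
    fd≡d = proj₁ (proj₂ broom)
    elsewhere = proj₂ (proj₂ broom)

  broom-cycle : d ≡ ~ c → FullVertexOnTwoCycle (Async f)
  broom-cycle d≡~c = c , antipodal⇒full f fc≡~c , flip c 0F ,
    antipodal-arc f fc≡~c 0F , (0F , differs′ , sym (flip-involutive c 0F))
    where
    fc≡~c = trans fc≡d d≡~c
    f-back : f (flip c 0F) ≡ c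
    f-back = elsewhere (flip c 0F) (flip-≢ c 0F) (λ e → flip-≢-~ c 0F (trans e d≡~c))
    differs′ : lookup (f (flip c 0F)) 0F ≢ lookup (flip c 0F) 0F
    differs′ e = not-¬ refl (trans (sym (cong (λ y → lookup y 0F) f-back)) (trans e (flip-same c 0F)))

  broom-acyclic : c ≢ d → d ≢ ~ c → ¬ FullVertexOnTwoCycle (Async f)
  broom-acyclic c≢d d≢~c (x , x-full , y , x→y , y→x) = antipodal-off-cycle (full⇒antipodal f x-full) x→y y→x
    where
    off-cycle-at-~c : ∀ {y} → Async f (~ c) y → Async f y (~ c) → ⊥
    off-cycle-at-~c {y} (i , _ , y≡~c+i) (j , differs , ~c≡y+j) with y ≟ d | y ≟ c
    ... | yes refl | _ = differs (cong (λ z → lookup z j) fd≡d)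
    ... | no _ | yes refl = flip-≢-~ (~ c) i (trans (sym y≡~c+i) (sym (~-involutive y)))
    ... | no y≢d | no y≢c = differs (trans (cong (λ z → lookup z j) (elsewhere y y≢c y≢d)) (sym yj≡cj))
      where
      j≡i : j ≡ i
      j≡i = flip-injective y (trans (sym ~c≡y+j) (trans (sym (flip-involutive (~ c) i)) (cong (λ z → flip z i) (sym y≡~c+i))))
      yj≡cj : lookup y j ≡ lookup c j
      yj≡cj = begin
        lookup y j               ≡⟨ cong (λ z → lookup z j) y≡~c+i ⟩
        lookup (flip (~ c) i) j  ≡⟨ cong (lookup (flip (~ c) i)) j≡i ⟩
        lookup (flip (~ c) i) i  ≡⟨ flip-same (~ c) i ⟩
        not (lookup (~ c) i)     ≡⟨ cong not (lookup-~ c i) ⟩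
        not (not (lookup c i))   ≡⟨ not-involutive _ ⟩
        lookup c i               ≡⟨ cong (lookup c) j≡i ⟨
        lookup c j               ∎
        where open ≡-Reasoning
    antipodal-off-cycle : ∀ {x y} → f x ≡ ~ x → Async f x y → Async f y x → ⊥
    antipodal-off-cycle {x} fx≡~x with x ≟ c | x ≟ d
    ... | yes refl | _ = λ _ _ → d≢~c (trans (sym fc≡d) fx≡~x)
    ... | no _ | yes refl = λ _ _ → ~-≢ d (sym (trans (sym fd≡d) fx≡~x))
    ... | no x≢c | no x≢d with ~-sym (trans (sym (elsewhere x x≢c x≢d)) fx≡~x)
    ...   | refl = off-cycle-at-~c

broom-separable : ∀ {m} {f : F (suc (suc m))} {c d} → Broom f c d → c ≢ d → Separable f
broom-separable {f = f} {c} {d} broom c≢d with d ≟ ~ c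
... | yes refl = h , conj-∼ (~ c) q f , λ iso →
  broom-acyclic h-broom (≢-sym (flip-≢ c 0F)) (flip-≢-~ c 0F)
    (twoCycle-transport {G = Async f} {Async h} (Iso-sym {G = Async h} iso) (broom-cycle broom refl))
  where
  q = flip c 0F
  h = conj (~ c) q f
  h-broom : Broom h c q
  h-broom = subst₂ (Broom h) (swap-other (~ c) q (≢-sym (~-≢ c)) (≢-sym (flip-≢ c 0F))) (swap-first (~ c) q)
                   (broom-conj (~ c) q broom)
... | no d≢~c = h , conj-∼ d (~ c) f , λ iso →
  broom-acyclic broom c≢d d≢~c (twoCycle-transport {G = Async h} {Async f} iso (broom-cycle h-broom refl))
  where
  h = conj d (~ c) f
  h-broom : Broom h c (~ c)
  h-broom = subst₂ (Broom h) (swap-other d (~ c) c≢d (≢-sym (~-≢ c))) (swap-first d (~ c)) (broom-conj d (~ c) broom)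

-- Maps balanced under all transpositions

SwapBalanced : ∀ {n} → F n → Set
SwapBalanced {n} f = ∀ (a b : Config n) → b ≢ a → b ≢ ~ a → linkedAcross f a b ≡ linkedWithin f a b

linked-comm : ∀ {n} (g : F n) x y → linked g x y ≡ linked g y x
linked-comm g x y = +-comm (δ (g x) y) (δ (g y) x)

linked-~~ : ∀ {n} (g : F n) x y → linked g x (~ ~ y) ≡ linked g x y
linked-~~ g x y = cong (λ z → δ (g x) z + δ (g z) x) (~-involutive y)

balanced-dual : ∀ {n} {f : F (suc n)} → SwapBalanced f → ∀ {a b} → b ≢ a → b ≢ ~ a →
                linked f a b + linked f (~ a) (~ b) ≡ linkedWithin f a b
balanced-dual {f = f} balanced {a} {b} b≢a b≢~a = begin
  linked f a b + linked f (~ a) (~ b)          ≡⟨ cong₂ _+_ (linked-~~ f a b) (linked-comm f (~ b) (~ a)) ⟨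
  linkedAcross f a (~ b)                       ≡⟨ balanced a (~ b) (b≢~a ∘ ~-sym ∘ sym) (b≢a ∘ ~-injective) ⟩
  linked f a (~ a) + linked f (~ b) (~ ~ b)    ≡⟨ cong (linked f a (~ a) +_) (trans (linked-~~ f (~ b) b) (linked-comm f (~ b) b)) ⟩
  linkedWithin f a b                           ∎
  where open ≡-Reasoning

AtMostOne : Bool → Bool → Bool → Set
AtMostOne b₁ b₂ b₃ = T (not (b₁ ∧ b₂)) × T (not (b₁ ∧ b₃)) × T (not (b₂ ∧ b₃))

at-most-one : ∀ {n} (v : Config n) {x y z} → x ≢ y → x ≢ z → y ≢ z →
              AtMostOne (does (v ≟ x)) (does (v ≟ y)) (does (v ≟ z))
at-most-one v x≢y x≢z y≢z = exclusive x≢y , exclusive x≢z , exclusive y≢z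
  where
  exclusive : ∀ {x y} → x ≢ y → T (not (does (v ≟ x) ∧ does (v ≟ y)))
  exclusive {x} {y} x≢y with v ≟ x | v ≟ y
  ... | yes v≡x | yes v≡y = x≢y (trans (sym v≡x) v≡y)
  ... | yes _ | no _ = _
  ... | no _ | _ = _

-- u₁ u₂ u₃ record whether f q is ~ p, p, ~ q; v₁ v₂ v₃ whether f (~ p) is q, ~ q, p;
-- w₁ w₂ w₃ whether f (~ q) is p, ~ p, q.  The two equations are the balance at (p, q) and (p, ~ q).
NeighbourhoodTable : (u₁ u₂ u₃ v₁ v₂ v₃ w₁ w₂ w₃ : Bool) → Set
NeighbourhoodTable u₁ u₂ u₃ v₁ v₂ v₃ w₁ w₂ w₃ =
  AtMostOne u₁ u₂ u₃ → AtMostOne v₁ v₂ v₃ → AtMostOne w₁ w₂ w₃ →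
  𝟙 w₁ + (𝟙 u₁ + 𝟙 v₁) ≡ suc (𝟙 v₃ + (𝟙 u₃ + 𝟙 w₃)) →
  𝟙 u₂ + (𝟙 v₂ + 𝟙 w₂) ≡ suc (𝟙 v₃ + (𝟙 u₃ + 𝟙 w₃)) →
  T (not v₃) × T (not u₃) × T (not w₃) ×
  (T (not v₁) → T (not v₂) → (T u₂ × T w₁) ⊎ (T u₁ × T w₂)) ×
  (T v₁ → (T u₂ × T (not w₁) × T (not w₂)) ⊎ (T w₂ × T (not u₂) × T (not u₁)))

-- An exhaustive check of all 2⁹ valuations, kept opaque so that no use ever unfolds it.
opaque
  neighbourhood-table : ∀ u₁ u₂ u₃ v₁ v₂ v₃ w₁ w₂ w₃ → NeighbourhoodTable u₁ u₂ u₃ v₁ v₂ v₃ w₁ w₂ w₃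
  neighbourhood-table = from-yes
    (Bool-all? λ u₁ → Bool-all? λ u₂ → Bool-all? λ u₃ → Bool-all? λ v₁ → Bool-all? λ v₂ → Bool-all? λ v₃ →
     Bool-all? λ w₁ → Bool-all? λ w₂ → Bool-all? λ w₃ → table? u₁ u₂ u₃ v₁ v₂ v₃ w₁ w₂ w₃)
    where
    Bool-all? : {P : Bool → Set} → (∀ b → Dec (P b)) → Dec (∀ b → P b)
    Bool-all? P? = map′ (λ (pt , pf) → λ { true → pt ; false → pf }) (λ p → p true , p false) (P? true ×-dec P? false)
    at-most-one? : ∀ b₁ b₂ b₃ → Dec (AtMostOne b₁ b₂ b₃)
    at-most-one? b₁ b₂ b₃ = T? (not (b₁ ∧ b₂)) ×-dec T? (not (b₁ ∧ b₃)) ×-dec T? (not (b₂ ∧ b₃))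
    table? : ∀ u₁ u₂ u₃ v₁ v₂ v₃ w₁ w₂ w₃ → Dec (NeighbourhoodTable u₁ u₂ u₃ v₁ v₂ v₃ w₁ w₂ w₃)
    table? u₁ u₂ u₃ v₁ v₂ v₃ w₁ w₂ w₃ =
      at-most-one? u₁ u₂ u₃ →-dec at-most-one? v₁ v₂ v₃ →-dec at-most-one? w₁ w₂ w₃ →-dec
      (_ ℕ.≟ _) →-dec (_ ℕ.≟ _) →-dec
      (T? (not v₃) ×-dec T? (not u₃) ×-dec T? (not w₃) ×-dec
       (T? (not v₁) →-dec T? (not v₂) →-dec ((T? u₂ ×-dec T? w₁) ⊎-dec (T? u₁ ×-dec T? w₂))) ×-dec
       (T? v₁ →-dec ((T? u₂ ×-dec T? (not w₁) ×-dec T? (not w₂)) ⊎-dec (T? w₂ ×-dec T? (not u₂) ×-dec T? (not u₁)))))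

module _ {n : ℕ} {x y : Config n} where

  T-does⇒≡ : T (does (x ≟ y)) → x ≡ y
  T-does⇒≡ t with x ≟ y
  ... | yes x≡y = x≡y

  T-not-does⇒≢ : T (not (does (x ≟ y))) → x ≢ y
  T-not-does⇒≢ t with x ≟ y
  ... | no x≢y = x≢y

  ≡⇒T-does : x ≡ y → T (does (x ≟ y))
  ≡⇒T-does x≡y with x ≟ y
  ... | yes _ = _
  ... | no x≢y = x≢y x≡y

  ≢⇒T-not-does : x ≢ y → T (not (does (x ≟ y)))
  ≢⇒T-not-does x≢y with x ≟ y
  ... | yes x≡y = x≢y x≡y
  ... | no _ = _

record AroundAntipodal {n} (f : F n) (p q : Config n) : Set where
  field
    ~p-not-to-p : f (~ p) ≢ p
    q-unlinked  : Unlinked f q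
    off-pair    : f (~ p) ≢ q → f (~ p) ≢ ~ q → (f q ≡ p × f (~ q) ≡ p) ⊎ (f q ≡ ~ p × f (~ q) ≡ ~ p)
    on-pair     : f (~ p) ≡ q → (f q ≡ p × f (~ q) ≢ p × f (~ q) ≢ ~ p) ⊎ (f (~ q) ≡ ~ p × f q ≢ p × f q ≢ ~ p)

around-antipodal : ∀ {n} {f : F (suc n)} → SwapBalanced f → ∀ {p} → f p ≡ ~ p →
                   ∀ {q} → q ≢ p → q ≢ ~ p → AroundAntipodal f p q
around-antipodal {f = f} balanced {p} fp≡~p {q} q≢p q≢~p =
  let ¬v₃ , ¬u₃ , ¬w₃ , off , on = table in record
  { ~p-not-to-p = T-not-does⇒≢ ¬v₃
  ; q-unlinked  = T-not-does⇒≢ ¬u₃ , T-not-does⇒≢ ¬w₃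
  ; off-pair    = λ v₁ v₂ → Sum.map (Product.map T-does⇒≡ T-does⇒≡) (Product.map T-does⇒≡ T-does⇒≡)
                              (off (≢⇒T-not-does v₁) (≢⇒T-not-does v₂))
  ; on-pair     = λ v₁ → Sum.map (Product.map T-does⇒≡ (Product.map T-not-does⇒≢ T-not-does⇒≢))
                                 (Product.map T-does⇒≡ (Product.map T-not-does⇒≢ T-not-does⇒≢))
                           (on (≡⇒T-does v₁))
  }
  where
  ~p≢p = ~-≢ p
  p≢~p = ≢-sym ~p≢p
  ~p≢~q = q≢p ∘ sym ∘ ~-injective
  p≢~q = q≢~p ∘ ~-sym
  q≢~q = ≢-sym (~-≢ q)
  ~q≢p = q≢~p ∘ ~-sym ∘ sym
  drop-constants : ∀ {x₀ y₀ r₁ r₂ s₁ s₂} → x₀ ≡ 0 → y₀ ≡ 1 →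
                   (x₀ + r₁) + r₂ ≡ (y₀ + s₁) + s₂ → r₁ + r₂ ≡ suc (s₁ + s₂)
  drop-constants refl refl e = e
  E₁ : δ (f (~ q)) p + (δ (f q) (~ p) + δ (f (~ p)) q) ≡ suc (δ (f (~ p)) p + (δ (f q) (~ q) + δ (f (~ q)) q))
  E₁ = drop-constants (δ-≢ (λ e → q≢p (sym (~-injective (trans (sym fp≡~p) e))))) (δ-≡ fp≡~p) (balanced p q q≢p q≢~p)
  E₂ : δ (f q) p + (δ (f (~ p)) (~ q) + δ (f (~ q)) (~ p)) ≡ suc (δ (f (~ p)) p + (δ (f q) (~ q) + δ (f (~ q)) q))
  E₂ = drop-constants (δ-≢ (λ e → q≢~p (sym (trans (sym fp≡~p) e)))) (δ-≡ fp≡~p) (balanced-dual {f = f} balanced q≢p q≢~p)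
  table = neighbourhood-table
    (does (f q ≟ ~ p)) (does (f q ≟ p)) (does (f q ≟ ~ q))
    (does (f (~ p) ≟ q)) (does (f (~ p) ≟ ~ q)) (does (f (~ p) ≟ p))
    (does (f (~ q) ≟ p)) (does (f (~ q) ≟ ~ p)) (does (f (~ q) ≟ q))
    (at-most-one (f q) ~p≢p ~p≢~q p≢~q) (at-most-one (f (~ p)) q≢~q q≢p ~q≢p)
    (at-most-one (f (~ q)) p≢~p (≢-sym q≢p) (≢-sym q≢~p)) E₁ E₂

module Balanced {m : ℕ} (f : F (suc (suc (suc m)))) (balanced : SwapBalanced f)
             (non-constant : ¬ IsConstant f) (non-identity : ¬ IsIdentity f) where

  no-antipodal-point : (∀ x → f x ≢ ~ x) → Separable f
  no-antipodal-point none with any? (λ x → ¬? (f x ≟ x))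
  ... | no all-fixed = ⊥-elim (non-identity λ x → decidable-stable (f x ≟ x) λ fx≢x → all-fixed (x , fx≢x))
  ... | yes (x , fx≢x) = separable-from-arc {f = f} {f} (Iso-refl (Sync f)) refl fx≢x (none x) (unlinked x) (unlinked (f x))
    where
    unlinked : ∀ a → Unlinked f a
    unlinked a = none a , λ e → none (~ a) (trans e (sym (~-involutive a)))

  module _ {p} (fp≡~p : f p ≡ ~ p) where
    private
      around : ∀ {q} → q ≢ p → q ≢ ~ p → AroundAntipodal f p q
      around = around-antipodal balanced fp≡~p
      p≢~p : p ≢ ~ p
      p≢~p = ≢-sym (~-≢ p)
      open AroundAntipodal renaming (q-unlinked to unlinked-at)

    module _ (f~p≡~p : f (~ p) ≡ ~ p) where

      pair-image : ∀ {x} → x ≢ p → x ≢ ~ p → (f x ≡ p × f (~ x) ≡ p) ⊎ (f x ≡ ~ p × f (~ x) ≡ ~ p)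
      pair-image x≢p x≢~p = off-pair (around x≢p x≢~p)
        (λ e → x≢~p (sym (trans (sym f~p≡~p) e))) (λ e → x≢p (sym (~-injective (trans (sym f~p≡~p) e))))

      arc-to-p : ∀ {q r} → q ≢ p → q ≢ ~ p → f q ≡ p → r ≢ p → r ≢ ~ p → f r ≡ ~ p → Separable f
      arc-to-p {q} {r} q≢p q≢~p fq≡p r≢p r≢~p fr≡~p =
        separable-from-arc {f = f} {g} {q} {p} (conj-∼ (~ p) r f) gq≡p (≢-sym q≢p) (q≢~p ∘ ~-sym) q-unlinked p-unlinked
        where
        g = conj (~ p) r f
        f~q≡p : f (~ q) ≡ p
        f~q≡p = Sum.[ proj₂ , (λ (fq≡~p , _) → ⊥-elim (p≢~p (trans (sym fq≡p) fq≡~p))) ]′ (pair-image q≢p q≢~p)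
        r-is-not : ∀ {x} → f x ≡ p → x ≢ r
        r-is-not fx≡p x≡r = p≢~p (trans (sym fx≡p) (trans (cong f x≡r) fr≡~p))
        τp≡p : swap (~ p) r p ≡ p
        τp≡p = swap-other (~ p) r p≢~p (≢-sym r≢p)
        gq≡p = conj-eval f (swap-other (~ p) r q≢~p (r-is-not fq≡p)) fq≡p τp≡p
        g~q≡p = conj-eval f (swap-other (~ p) r (q≢p ∘ ~-injective) (r-is-not f~q≡p)) f~q≡p τp≡p
        gp≡r = conj-eval f τp≡p fp≡~p (swap-first (~ p) r)
        g~p≡r = conj-eval f (swap-first (~ p) r) fr≡~p (swap-first (~ p) r)
        q-unlinked : Unlinked g q
        q-unlinked = (λ e → q≢~p (~-sym (trans (sym gq≡p) e))) , (λ e → q≢p (sym (trans (sym g~q≡p) e)))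
        p-unlinked : Unlinked g p
        p-unlinked = (λ e → r≢~p (trans (sym gp≡r) e)) , (λ e → r≢p (trans (sym g~p≡r) e))

      ~p-fixed : Separable f
      ~p-fixed with any? (λ x → ¬? (x ≟ p) ×-dec ¬? (x ≟ ~ p) ×-dec f x ≟ ~ p)
      ... | no none = broom-separable broom p≢~p
        where
        broom : Broom f p (~ p)
        broom = fp≡~p , f~p≡~p , λ x x≢p x≢~p →
          Sum.[ proj₁ , (λ (fx≡~p , _) → ⊥-elim (none (x , x≢p , x≢~p , fx≡~p))) ]′ (pair-image x≢p x≢~p)
      ... | yes (r , r≢p , r≢~p , fr≡~p) with any? (λ x → ¬? (x ≟ p) ×-dec ¬? (x ≟ ~ p) ×-dec f x ≟ p)
      ...   | yes (q , q≢p , q≢~p , fq≡p) = arc-to-p q≢p q≢~p fq≡p r≢p r≢~p fr≡~p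
      ...   | no none = ⊥-elim (non-constant (~ p , constant))
        where
        constant : ∀ x → f x ≡ ~ p
        constant x with x ≟ p | x ≟ ~ p
        ... | yes refl | _ = fp≡~p
        ... | no _ | yes refl = f~p≡~p
        ... | no x≢p | no x≢~p =
          Sum.[ (λ (fx≡p , _) → ⊥-elim (none (x , x≢p , x≢~p , fx≡p))) , proj₁ ]′ (pair-image x≢p x≢~p)

    module _ (f~p≢~p : f (~ p) ≢ ~ p) where
      private
        u = f (~ p)
        u≢p : u ≢ p
        u≢p = ~p-not-to-p (around (flip-≢ p 0F) (flip-≢-~ p 0F))
        u-unlinked : Unlinked f u
        u-unlinked = unlinked-at (around u≢p f~p≢~p)
        ~u≢p : ~ u ≢ p
        ~u≢p = f~p≢~p ∘ ~-sym ∘ sym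

      module _ {q} (q≢p : q ≢ p) (q≢~p : q ≢ ~ p) (q≢u : q ≢ u) (q≢~u : q ≢ ~ u) where
        private
          g = conj p q f
          τ~p : swap p q (~ p) ≡ ~ p
          τ~p = swap-other p q (~-≢ p) (≢-sym q≢~p)
          τu : swap p q u ≡ u
          τu = swap-other p q u≢p (≢-sym q≢u)
          τ~u : swap p q (~ u) ≡ ~ u
          τ~u = swap-other p q ~u≢p (≢-sym q≢~u)

        u-unlinked-if-u↦p : f u ≡ p → f (~ u) ≡ ~ u → Unlinked g u
        u-unlinked-if-u↦p fu≡p f~u≡~u =
          (λ e → q≢~u (trans (sym gu≡q) e)) , (λ e → ~-≢ u (trans (sym g~u≡~u) e))
          where
          gu≡q = conj-eval f τu fu≡p (swap-first p q)
          g~u≡~u = conj-eval f τ~u f~u≡~u τ~u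

        u-unlinked-if-u-fixed : f u ≡ u → f (~ u) ≡ ~ p → Unlinked g u
        u-unlinked-if-u-fixed fu≡u f~u≡~p =
          (λ e → ~-≢ u (sym (trans (sym gu≡u) e))) , (λ e → f~p≢~p (sym (trans (sym g~u≡~p) e)))
          where
          gu≡u = conj-eval f τu fu≡u τu
          g~u≡~p = conj-eval f τ~u f~u≡~p τ~p

        arc-from-~p : f q ≡ p → Unlinked g u → Separable f
        arc-from-~p fq≡p u-unlinked-in-g =
          separable-from-arc {f = f} {g} {~ p} {u} (conj-∼ p q f) g~p≡u f~p≢~p (λ e → u≢p (trans e (~-involutive p)))
            (unlinked-~ {g = g} p-unlinked-in-g) u-unlinked-in-g
          where
          g~p≡u = conj-eval f τ~p refl τu
          gp≡q = conj-eval f (swap-first p q) fq≡p (swap-first p q)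
          p-unlinked-in-g : Unlinked g p
          p-unlinked-in-g = (λ e → q≢~p (trans (sym gp≡q) e)) , (λ e → u≢p (trans (sym g~p≡u) e))

        arc-from-u : f u ≡ p → f (~ u) ≡ ~ u → f q ≡ ~ p → f (~ q) ≡ ~ p → Separable f
        arc-from-u fu≡p f~u≡~u fq≡~p f~q≡~p =
          separable-from-arc {f = f} {g} {u} {q} (conj-∼ p q f) gu≡q q≢u q≢~u
            (u-unlinked-if-u↦p fu≡p f~u≡~u) q-unlinked-in-g
          where
          gu≡q = conj-eval f τu fu≡p (swap-first p q)
          gq≡~p = conj-eval f (swap-second p q) fp≡~p τ~p
          g~q≡~p = conj-eval f (swap-other p q (q≢~p ∘ ~-sym ∘ sym) (~-≢ q)) f~q≡~p τ~p
          q-unlinked-in-g : Unlinked g q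
          q-unlinked-in-g = (λ e → q≢p (sym (~-injective (trans (sym gq≡~p) e)))) , (λ e → q≢~p (sym (trans (sym g~q≡~p) e)))

      u-to-p : f u ≡ p → f (~ u) ≢ p → f (~ u) ≢ ~ p → Separable f
      u-to-p fu≡p f~u≢p f~u≢~p with f (~ u) ≟ ~ u
      ... | no f~u≢~u = separable-from-arc {f = f} {f} (Iso-refl (Sync f)) refl f~u≢~u
              (λ e → proj₂ u-unlinked (trans e (~-involutive u)))
              (unlinked-~ {g = f} u-unlinked) (unlinked-at (around f~u≢p f~u≢~p))
      ... | yes f~u≡~u with outside-two-pairs p u
      ...   | q , q≢p , q≢~p , q≢u , q≢~u with off-pair (around q≢p q≢~p) (≢-sym q≢u) (q≢~u ∘ ~-sym)
      ...     | inj₁ (fq≡p , _) = arc-from-~p q≢p q≢~p q≢u q≢~u fq≡p (u-unlinked-if-u↦p q≢p q≢~p q≢u q≢~u fu≡p f~u≡~u)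
      ...     | inj₂ (fq≡~p , f~q≡~p) = arc-from-u q≢p q≢~p q≢u q≢~u fu≡p f~u≡~u fq≡~p f~q≡~p

      ~u-to-~p : f (~ u) ≡ ~ p → f u ≢ p → f u ≢ ~ p → Separable f
      ~u-to-~p f~u≡~p fu≢p fu≢~p with f u ≟ u
      ... | no fu≢u = separable-from-arc {f = f} {f} (Iso-refl (Sync f)) refl fu≢u (proj₁ u-unlinked) u-unlinked
                        (unlinked-at (around fu≢p fu≢~p))
      ... | yes fu≡u with any? (λ x → ¬? (x ≟ p) ×-dec ¬? (x ≟ ~ p) ×-dec ¬? (x ≟ u) ×-dec ¬? (x ≟ ~ u) ×-dec f x ≟ p)
      ...   | yes (q , q≢p , q≢~p , q≢u , q≢~u , fq≡p) =
        arc-from-~p q≢p q≢~p q≢u q≢~u fq≡p (u-unlinked-if-u-fixed q≢p q≢~p q≢u q≢~u fu≡u f~u≡~p)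
      ...   | no none = broom-separable {f = f} {~ p} {u} (refl , fu≡u , elsewhere) (≢-sym f~p≢~p)
        where
        elsewhere : ∀ x → x ≢ ~ p → x ≢ u → f x ≡ ~ p
        elsewhere x x≢~p x≢u with x ≟ p | x ≟ ~ u
        ... | yes refl | _ = fp≡~p
        ... | no _ | yes refl = f~u≡~p
        ... | no x≢p | no x≢~u = Sum.[ (λ (fx≡p , _) → ⊥-elim (none (x , x≢p , x≢~p , x≢u , x≢~u , fx≡p))) , proj₁ ]′
                                   (off-pair (around x≢p x≢~p) (≢-sym x≢u) (x≢~u ∘ ~-sym))

      ~p-moved : Separable f
      ~p-moved with on-pair (around u≢p f~p≢~p) refl
      ... | inj₁ (fu≡p , f~u≢p , f~u≢~p) = u-to-p fu≡p f~u≢p f~u≢~p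
      ... | inj₂ (f~u≡~p , fu≢p , fu≢~p) = ~u-to-~p f~u≡~p fu≢p fu≢~p

  separable : Separable f
  separable with any? (λ x → f x ≟ ~ x)
  ... | no none = no-antipodal-point (λ x fx≡~x → none (x , fx≡~x))
  ... | yes (p , fp≡~p) with f (~ p) ≟ ~ p
  ...   | yes f~p≡~p = ~p-fixed fp≡~p f~p≡~p
  ...   | no f~p≢~p = ~p-moved fp≡~p f~p≢~p

theorem2 : (n : ℕ) → n ≥ 3 → (f : F n) → ¬ IsConstant f → ¬ IsIdentity f →
    ∃ λ (h : F n) → (h ∼ f) × ¬ Iso (Async h) (Async f)
theorem2 (suc (suc (suc m))) (s≤s (s≤s (s≤s _))) f non-constant non-identity
  with any? (λ a → any? λ b → ¬? (b ≟ a) ×-dec ¬? (b ≟ ~ a) ×-dec ¬? (linkedAcross f a b ℕ.≟ linkedWithin f a b))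
... | yes (a , b , b≢a , b≢~a , unbalanced) = separable-if-unbalanced {f = f} {f} (Iso-refl (Sync f)) b≢a b≢~a unbalanced
... | no never-unbalanced = Balanced.separable f balanced non-constant non-identity
  where
  balanced : SwapBalanced f
  balanced a b b≢a b≢~a = decidable-stable (_ ℕ.≟ _) λ unbalanced → never-unbalanced (a , b , b≢a , b≢~a , unbalanced)
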